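{- Let $T$ be a tree with vertex set $\{1,\ldots,n\}$, edge set $\{e_1,\ldots,e_{n-1}\}$ and nonzero real edge weights $w_1,\ldots,w_{n-1}$. If $T$ has at least two vertices of degree $2$, then the squared distance matrix $\Delta$ of $T$ satisfies $\det\Delta=0$.
   Context: For vertices $i\neq j$, $d(i,j)$ is the sum of the weights of the edges on the unique $ij$-path, $d(i,i)=0$, and $\Delta$ is the $n\times n$ matrix with $(i,j)$-entry $d(i,j)^2$. -}

module Defs where

open import Level using (Level; _⊔_) renaming (suc to lsuc)
open import Algebra.Bundles using (CommutativeRing)
open import Data.Nat as ℕ using (ℕ; zero; suc)
open import Data.Fin using (Fin; zero; suc; punchIn; _≟_; toℕ)
open import Data.List using (List; []; _∷_; map; length; filter)
open import Data.List.Relation.Unary.Unique.Propositional using (Unique)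
open import Data.Product using (Σ; _×_; _,_; ∃; ∃-syntax; proj₁; proj₂)
open import Data.Sum using (_⊎_)
open import Data.Empty using (⊥)
open import Data.Unit using (⊤)
open import Relation.Nullary using (¬_)
open import Relation.Nullary.Decidable using (_⊎-dec_)
open import Relation.Binary.PropositionalEquality using (_≡_)
open import Data.List.Base using (allFin)

-- The real numbers, axiomatised: a complete ordered field.
-- (agda-stdlib has no ℝ; we quantify over every model of the axioms
--  of a Dedekind-complete ordered field, i.e. over ℝ up to isomorphism.)

record RealField (c ℓ : Level) : Set (lsuc (c ⊔ ℓ)) where
  field
    commRing : CommutativeRing c ℓ
  open CommutativeRing commRing public
  field
    _≤_        : Carrier → Carrier → Set ℓ
    ≤-respˡ    : ∀ {x y z} → x ≈ y → x ≤ z → y ≤ z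
    ≤-respʳ    : ∀ {x y z} → x ≈ y → z ≤ x → z ≤ y
    ≤-refl     : ∀ {x} → x ≤ x
    ≤-trans    : ∀ {x y z} → x ≤ y → y ≤ z → x ≤ z
    ≤-antisym  : ∀ {x y} → x ≤ y → y ≤ x → x ≈ y
    ≤-total    : ∀ x y → x ≤ y ⊎ y ≤ x
    +-mono-≤   : ∀ {x y} z → x ≤ y → (x + z) ≤ (y + z)
    *-nonneg   : ∀ {x y} → 0# ≤ x → 0# ≤ y → 0# ≤ (x * y)
    0≉1        : ¬ (0# ≈ 1#)
    inverse    : ∀ x → ¬ (x ≈ 0#) → ∃[ y ] (x * y ≈ 1#)
    sup        : (P : Carrier → Set c) → (∃[ x ] P x) →
                 (∃[ b ] (∀ x → P x → x ≤ b)) →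
                 ∃[ s ] ((∀ x → P x → x ≤ s) ×
                         (∀ b → (∀ x → P x → x ≤ b) → s ≤ b))

module Matrices {c ℓ} (R : CommutativeRing c ℓ) where
  open CommutativeRing R using (Carrier; _+_; _*_; -_; 0#; 1#)

  Σ[<_]_ : (n : ℕ) → (Fin n → Carrier) → Carrier
  Σ[< zero ] f = 0#
  Σ[< suc n ] f = f zero + Σ[< n ] (λ i → f (suc i))

  sgn : ℕ → Carrier
  sgn zero = 1#
  sgn (suc j) = - sgn j

  det : (n : ℕ) → (Fin n → Fin n → Carrier) → Carrier
  det zero M = 1#
  det (suc n) M =
    Σ[< suc n ] (λ j → sgn (toℕ j) * (M zero j *
      det n (λ a b → M (suc a) (punchIn j b))))

module Graphs {n m : ℕ} (ends : Fin m → Fin n × Fin n) where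

  Joins : Fin m → Fin n → Fin n → Set
  Joins e u v = (proj₁ (ends e) ≡ u × proj₂ (ends e) ≡ v)
              ⊎ (proj₁ (ends e) ≡ v × proj₂ (ends e) ≡ u)

  -- a walk from u: a list of steps (edge used, vertex reached)
  IsWalk : Fin n → List (Fin m × Fin n) → Set
  IsWalk u [] = ⊤
  IsWalk u ((e , v) ∷ s) = Joins e u v × IsWalk v s

  endpoint : Fin n → List (Fin m × Fin n) → Fin n
  endpoint u [] = u
  endpoint u ((e , v) ∷ s) = endpoint v s

  IsPath : Fin n → Fin n → List (Fin m × Fin n) → Set
  IsPath u v s = IsWalk u s × endpoint u s ≡ v × Unique (u ∷ map proj₂ s)

  IsCycle : Fin n → List (Fin m × Fin n) → Set
  IsCycle u s = ¬ (s ≡ []) × IsWalk u s × endpoint u s ≡ u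
              × Unique (map proj₁ s) × Unique (map proj₂ s)

  Connected : Set
  Connected = ∀ u v → ∃[ s ] (IsWalk u s × endpoint u s ≡ v)

  Acyclic : Set
  Acyclic = ∀ u s → ¬ IsCycle u s

  IsTree : Set
  IsTree = Connected × Acyclic

  degree : Fin n → ℕ
  degree v = length (filter (λ e → (proj₁ (ends e) ≟ v) ⊎-dec (proj₂ (ends e) ≟ v)) (allFin m))

-- Weighted trees: d(i,j) is the sum of the weights of the edges on the
-- (unique, in a tree) ij-path; Δ has (i,j)-entry d(i,j)².

module Weighted {c ℓ} (R : CommutativeRing c ℓ) {n m : ℕ}
                (ends : Fin m → Fin n × Fin n)
                (w : Fin m → CommutativeRing.Carrier R) where
  open CommutativeRing R using (Carrier; _≈_; _+_; _*_; 0#)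
  open Graphs ends

  pathWeight : List (Fin m × Fin n) → Carrier
  pathWeight [] = 0#
  pathWeight ((e , v) ∷ s) = w e + pathWeight s

  IsSquaredDistanceMatrix : (Fin n → Fin n → Carrier) → Set ℓ
  IsSquaredDistanceMatrix Δ =
    ∀ i j → ∃[ s ] (IsPath i j s × Δ i j ≈ (pathWeight s * pathWeight s))

-- If u has degree two, with neighbours a, b reached along edges of weights α, β, then every
-- u–j path passes through a or b (or is empty), and reading off the three distances along it gives
-- β Δ(a,j) + α Δ(b,j) − (α + β) Δ(u,j) = αβ(α + β) for all j: a combination of rows of Δ is
-- constant.  A second degree-two vertex v gives a second such combination.  Since the tree has no
-- cycles, a neighbour of u lies outside v and its neighbours, so the second combination vanishes
-- where the first does not; two such constant combinations force det Δ = 0.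
module Submission where

open import Defs
open import Algebra.Bundles using (CommutativeRing)
open import Data.Empty using (⊥; ⊥-elim)
open import Data.Fin using (Fin; zero; suc; punchIn; punchOut; toℕ; _≟_)
open import Data.Fin.Properties using (punchInᵢ≢i; punchOut-cong; punchOut-punchIn)
open import Data.List using (List; []; _∷_; map; _++_; filter; allFin)
open import Data.List.Membership.Propositional using (_∈_; _∉_)
open import Data.List.Membership.Propositional.Properties using (∈-++⁻; ∈-++⁺ʳ; ∈-filter⁺; ∈-filter⁻; ∈-allFin)
import Data.List.Membership.DecPropositional as DecMembership
open import Data.List.Properties using (map-++; ∷-injectiveˡ)
open import Data.List.Relation.Binary.Subset.Propositional using (_⊆_)
open import Data.List.Relation.Unary.All using (All; []; _∷_)
open import Data.List.Relation.Unary.All.Properties using (++⁻ˡ; ¬Any⇒All¬; All¬⇒¬Any)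
open import Data.List.Relation.Unary.AllPairs using ([]; _∷_)
open import Data.List.Relation.Unary.Any using (here; there)
open import Data.List.Relation.Unary.Unique.Propositional using (Unique)
open import Data.List.Relation.Unary.Unique.Propositional.Properties using (filter⁺; allFin⁺)
open import Data.Nat using (ℕ; zero; suc)
open import Data.Product using (Σ; ∃-syntax; _×_; _,_; proj₁; proj₂)
open import Data.Sum using (_⊎_; inj₁; inj₂; [_,_]′)
import Data.Sum as Sum
open import Data.Unit using (tt)
open import Data.Vec.Functional as Vector using (Vector; tail; removeAt; updateAt)
open import Data.Vec.Functional.Properties using (updateAt-updates; updateAt-minimal; updateAt-id-local; updateAt-commutes)
open import Function using (_∘_; const)
open import Level using (_⊔_)
open import Relation.Nullary using (¬_; Dec; yes; no)
open import Relation.Nullary.Decidable using (_⊎-dec_)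
open import Relation.Binary.PropositionalEquality as ≡ using (_≡_; _≢_; _≗_)

infixl 6 _[_]≔_

_[_]≔_ : ∀ {a} {A : Set a} {n} → Vector A n → Fin n → A → Vector A n
xs [ i ]≔ x = updateAt xs i (const x)

module _ {a} {A : Set a} where

  []≔-updates : ∀ {n} (xs : Vector A n) i {x} → (xs [ i ]≔ x) i ≡ x
  []≔-updates xs i = updateAt-updates i xs

  []≔-minimal : ∀ {n} (xs : Vector A n) {i j} {x} → j ≢ i → (xs [ i ]≔ x) j ≡ xs j
  []≔-minimal xs {i} {j} = updateAt-minimal j i xs

  []≔-self : ∀ {n} (xs : Vector A n) i → xs [ i ]≔ xs i ≗ xs
  []≔-self xs i = updateAt-id-local i xs ≡.refl

  []≔-cong : ∀ {n} {xs ys : Vector A n} → xs ≗ ys → ∀ i x → xs [ i ]≔ x ≗ ys [ i ]≔ x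
  []≔-cong eq zero    x zero    = ≡.refl
  []≔-cong eq zero    x (suc k) = eq (suc k)
  []≔-cong eq (suc i) x zero    = eq zero
  []≔-cong eq (suc i) x (suc k) = []≔-cong (eq ∘ suc) i x k

  []≔-map : ∀ {b} {B : Set b} {n} (f : A → B) (xs : Vector A n) i x →
            Vector.map f (xs [ i ]≔ x) ≗ Vector.map f xs [ i ]≔ f x
  []≔-map f xs zero    x zero    = ≡.refl
  []≔-map f xs zero    x (suc k) = ≡.refl
  []≔-map f xs (suc i) x zero    = ≡.refl
  []≔-map f xs (suc i) x (suc k) = []≔-map f (tail xs) i x k

double-punchIn-symmetric : ∀ {n} (j k : Fin (suc (suc n))) (j≢k : j ≢ k) (k≢j : k ≢ j) (y : Fin n) →
                           punchIn j (punchIn (punchOut j≢k) y) ≡ punchIn k (punchIn (punchOut k≢j) y)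
double-punchIn-symmetric zero    zero    j≢k _ y = ⊥-elim (j≢k ≡.refl)
double-punchIn-symmetric zero    (suc k) _   _ y = ≡.refl
double-punchIn-symmetric (suc j) zero    _   _ y = ≡.refl
double-punchIn-symmetric {suc n} (suc j) (suc k) _ _ zero = ≡.refl
double-punchIn-symmetric {suc n} (suc j) (suc k) j≢k k≢j (suc y) =
  ≡.cong suc (double-punchIn-symmetric j k (j≢k ∘ ≡.cong suc) (k≢j ∘ ≡.cong suc) y)

module Determinant {c ℓ} (R : CommutativeRing c ℓ) where
  open CommutativeRing R hiding (zero)
  open Matrices R
  open import Algebra.Properties.Ring ring
    using (-‿distribˡ-*; -‿distribʳ-*; -‿involutive; -0#≈0#; -1*x≈-x; +-inverseʳ-unique)
  open import Algebra.Properties.Semiring.Sum semiring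
    using (sum; sum-cong-≋; ∑-distrib-+; *-distribˡ-sum; sum-remove; sum-replicate-zero)
  open import Algebra.Solver.Ring.NaturalCoefficients.Default commutativeSemiring
    using (solve; _:+_; _:*_; _:=_)
  open import Relation.Binary.Reasoning.Setoid setoid

  Matrix : ℕ → Set c
  Matrix n = Vector (Vector Carrier n) n

  sign : ∀ {n} → Fin n → Carrier
  sign j = sgn (toℕ j)

  minor : ∀ {n} → Matrix (suc n) → Fin (suc n) → Matrix n
  minor M j = Vector.map (λ row → removeAt row j) (tail M)

  laplaceTerm : ∀ {n} → Matrix (suc n) → Fin (suc n) → Carrier
  laplaceTerm {n} M j = sign j * (M zero j * det n (minor M j))

  Σ≡sum : ∀ {n} (f : Vector Carrier n) → Σ[< n ] f ≡ sum f
  Σ≡sum {zero}  f = ≡.refl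
  Σ≡sum {suc n} f = ≡.cong (f zero +_) (Σ≡sum (tail f))

  det-laplace : ∀ {n} (M : Matrix (suc n)) → det (suc n) M ≈ sum (laplaceTerm M)
  det-laplace M = reflexive (Σ≡sum (laplaceTerm M))

  sum-zero : ∀ {n} {f : Vector Carrier n} → (∀ i → f i ≈ 0#) → sum f ≈ 0#
  sum-zero {n} f≈0 = trans (sum-cong-≋ f≈0) (sum-replicate-zero n)

  sum-linear : ∀ {n} k {t u v : Vector Carrier n} → (∀ j → t j ≈ k * u j + v j) →
               sum t ≈ k * sum u + sum v
  sum-linear k {t} {u} {v} t≈ = begin
    sum t                        ≈⟨ sum-cong-≋ t≈ ⟩
    sum (λ j → k * u j + v j)    ≈⟨ ∑-distrib-+ (λ j → k * u j) v ⟩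
    sum (λ j → k * u j) + sum v  ≈⟨ +-congʳ (*-distribˡ-sum k u) ⟨
    k * sum u + sum v            ∎

  -- The diagonal hypothesis is needed: antisymmetry alone only gives 2 · Σ = 0.
  sum-antisymmetric : ∀ {n} (h : Fin n → Fin n → Carrier) →
                      (∀ j k → h j k ≈ - h k j) → (∀ j → h j j ≈ 0#) → sum (λ j → sum (h j)) ≈ 0#
  sum-antisymmetric {zero}  h _    _    = refl
  sum-antisymmetric {suc n} h anti diag = begin
    (h zero zero + row₀) + sum (λ j → h (suc j) zero + sum (h (suc j) ∘ suc))
      ≈⟨ +-cong (+-congʳ (diag zero)) (∑-distrib-+ col₀ (λ j → sum (h (suc j) ∘ suc))) ⟩
    (0# + row₀) + (sum col₀ + sum (λ j → sum (h (suc j) ∘ suc)))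
      ≈⟨ +-cong (+-identityˡ row₀) (+-congˡ (sum-antisymmetric (λ j k → h (suc j) (suc k))
                                               (λ j k → anti (suc j) (suc k)) (diag ∘ suc))) ⟩
    row₀ + (sum col₀ + 0#)       ≈⟨ +-congˡ (+-identityʳ _) ⟩
    row₀ + sum col₀              ≈⟨ ∑-distrib-+ (h zero ∘ suc) col₀ ⟨
    sum (λ k → h zero (suc k) + h (suc k) zero)
      ≈⟨ sum-zero (λ k → trans (+-congʳ (anti zero (suc k))) (-‿inverseˡ _)) ⟩
    0#                           ∎
    where
    row₀ = sum (h zero ∘ suc)
    col₀ = λ j → h (suc j) zero

  det-cong : ∀ {n} {M N : Matrix n} → (∀ i j → M i j ≈ N i j) → det n M ≈ det n N
  det-cong {zero}  _   = refl
  det-cong {suc n} {M} {N} M≈N = begin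
    det (suc n) M      ≈⟨ det-laplace M ⟩
    sum (laplaceTerm M)
      ≈⟨ sum-cong-≋ (λ j → *-congˡ {sign j} (*-cong (M≈N zero j) (det-cong (λ a b → M≈N (suc a) (punchIn j b))))) ⟩
    sum (laplaceTerm N) ≈⟨ det-laplace N ⟨
    det (suc n) N      ∎

  det-cong-≗ : ∀ {n} {M N : Matrix n} → M ≗ N → det n M ≈ det n N
  det-cong-≗ M≗N = det-cong (λ i j → reflexive (≡.cong-app (M≗N i) j))

  det-row-cong : ∀ {n} (M : Matrix n) p {r s : Vector Carrier n} → (∀ j → r j ≈ s j) →
                 det n (M [ p ]≔ r) ≈ det n (M [ p ]≔ s)
  det-row-cong M p {r} {s} r≈s = det-cong entry
    where
    entry : ∀ i j → (M [ p ]≔ r) i j ≈ (M [ p ]≔ s) i j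
    entry i j with i ≟ p
    ... | yes ≡.refl = trans (reflexive (≡.cong-app ([]≔-updates M i {r}) j))
                             (trans (r≈s j) (reflexive (≡.cong-app (≡.sym ([]≔-updates M i {s})) j)))
    ... | no i≢p = reflexive (≡.cong-app (≡.trans ([]≔-minimal M i≢p) (≡.sym ([]≔-minimal M i≢p))) j)

  minor-[]≔ : ∀ {n} (M : Matrix (suc n)) p r j → minor (M [ suc p ]≔ r) j ≗ minor M j [ p ]≔ removeAt r j
  minor-[]≔ M p r j = []≔-map (λ row → removeAt row j) (tail M) p r

  det-linear : ∀ {n} (M : Matrix n) p k (r s : Vector Carrier n) →
               det n (M [ p ]≔ (λ j → k * r j + s j)) ≈ k * det n (M [ p ]≔ r) + det n (M [ p ]≔ s)
  det-linear {suc n} M zero k r s = begin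
    det (suc n) (M [ zero ]≔ t)        ≈⟨ det-laplace (M [ zero ]≔ t) ⟩
    sum (laplaceTerm (M [ zero ]≔ t))  ≈⟨ sum-linear k (λ j → split k (sign j) (r j) (s j) (det n (minor M j))) ⟩
    k * sum (laplaceTerm (M [ zero ]≔ r)) + sum (laplaceTerm (M [ zero ]≔ s))
      ≈⟨ +-cong (*-congˡ (det-laplace (M [ zero ]≔ r))) (det-laplace (M [ zero ]≔ s)) ⟨
    k * det (suc n) (M [ zero ]≔ r) + det (suc n) (M [ zero ]≔ s)    ∎
    where
    t = λ j → k * r j + s j
    split : ∀ k σ x y d → σ * ((k * x + y) * d) ≈ k * (σ * (x * d)) + σ * (y * d)
    split = solve 5 (λ k σ x y d → σ :* ((k :* x :+ y) :* d) := k :* (σ :* (x :* d)) :+ σ :* (y :* d)) refl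
  det-linear {suc n} M (suc p) k r s = begin
    det (suc n) (M [ suc p ]≔ t)             ≈⟨ det-laplace (M [ suc p ]≔ t) ⟩
    sum (laplaceTerm (M [ suc p ]≔ t))       ≈⟨ sum-linear k term ⟩
    k * sum (laplaceTerm (M [ suc p ]≔ r)) + sum (laplaceTerm (M [ suc p ]≔ s))
      ≈⟨ +-cong (*-congˡ (det-laplace (M [ suc p ]≔ r))) (det-laplace (M [ suc p ]≔ s)) ⟨
    k * det (suc n) (M [ suc p ]≔ r) + det (suc n) (M [ suc p ]≔ s) ∎
    where
    t = λ j → k * r j + s j

    minorDet : ∀ x j → det n (minor (M [ suc p ]≔ x) j) ≈ det n (minor M j [ p ]≔ removeAt x j)
    minorDet x j = det-cong-≗ (minor-[]≔ M p x j)

    split : ∀ k σ m x y → σ * (m * (k * x + y)) ≈ k * (σ * (m * x)) + σ * (m * y)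
    split = solve 5 (λ k σ m x y → σ :* (m :* (k :* x :+ y)) := k :* (σ :* (m :* x)) :+ σ :* (m :* y)) refl

    term : ∀ j → laplaceTerm (M [ suc p ]≔ t) j ≈ k * laplaceTerm (M [ suc p ]≔ r) j + laplaceTerm (M [ suc p ]≔ s) j
    term j = begin
      sign j * (M zero j * det n (minor (M [ suc p ]≔ t) j))
        ≈⟨ *-congˡ (*-congˡ (trans (minorDet t j) (det-linear (minor M j) p k (removeAt r j) (removeAt s j)))) ⟩
      sign j * (M zero j * (k * Dr + Ds))                          ≈⟨ split k (sign j) (M zero j) Dr Ds ⟩
      k * (sign j * (M zero j * Dr)) + sign j * (M zero j * Ds)
        ≈⟨ +-cong (*-congˡ (*-congˡ (*-congˡ (minorDet r j)))) (*-congˡ (*-congˡ (minorDet s j))) ⟨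
      k * laplaceTerm (M [ suc p ]≔ r) j + laplaceTerm (M [ suc p ]≔ s) j ∎
      where
      Dr = det n (minor M j [ p ]≔ removeAt r j)
      Ds = det n (minor M j [ p ]≔ removeAt s j)

  det-zeroRow : ∀ {n} (M : Matrix n) p → det n (M [ p ]≔ (λ _ → 0#)) ≈ 0#
  det-zeroRow {n} M p = begin
    d                                       ≈⟨ det-row-cong M p (λ _ → trans (+-identityʳ _) (zeroʳ _)) ⟨
    det n (M [ p ]≔ (λ _ → - 1# * 0# + 0#))  ≈⟨ det-linear M p (- 1#) (λ _ → 0#) (λ _ → 0#) ⟩
    - 1# * d + d                            ≈⟨ +-congʳ (-1*x≈-x d) ⟩
    - d + d                                 ≈⟨ -‿inverseˡ d ⟩
    0#                                      ∎
    where d = det n (M [ p ]≔ (λ _ → 0#))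

  det-scaleRow : ∀ {n} (M : Matrix n) p k r → det n (M [ p ]≔ (λ j → k * r j)) ≈ k * det n (M [ p ]≔ r)
  det-scaleRow {n} M p k r = begin
    det n (M [ p ]≔ (λ j → k * r j))      ≈⟨ det-row-cong M p (λ _ → +-identityʳ _) ⟨
    det n (M [ p ]≔ (λ j → k * r j + 0#)) ≈⟨ det-linear M p k r (λ _ → 0#) ⟩
    k * det n (M [ p ]≔ r) + det n (M [ p ]≔ (λ _ → 0#)) ≈⟨ +-congˡ (det-zeroRow M p) ⟩
    k * det n (M [ p ]≔ r) + 0#           ≈⟨ +-identityʳ _ ⟩
    k * det n (M [ p ]≔ r)                ∎

  Alternating : ℕ → Set (c ⊔ ℓ)
  Alternating n = ∀ (M : Matrix n) {p q} → p ≢ q → (∀ j → M p j ≈ M q j) → det n M ≈ 0#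

  det-swapRows : ∀ {n} → Alternating n → ∀ (M : Matrix n) {p q} → p ≢ q →
                 det n (M [ q ]≔ M p [ p ]≔ M q) ≈ - det n M
  det-swapRows {n} alternating M {p} {q} p≢q = +-inverseʳ-unique (det n M) (det n (X (M q) (M p))) (begin
    det n M + det n (X (M q) (M p))
      ≈⟨ +-cong (+-identityˡ _) (+-identityʳ _) ⟨
    (0# + det n M) + (det n (X (M q) (M p)) + 0#)
      ≈⟨ +-cong (+-cong (equal (M p)) (det-cong-≗ self)) (+-congˡ (equal (M q))) ⟨
    (det n (X (M p) (M p)) + det n (X (M p) (M q))) + (det n (X (M q) (M p)) + det n (X (M q) (M q)))
      ≈⟨ +-cong (linearʳ (M p)) (linearʳ (M q)) ⟨
    det n (X (M p) t) + det n (X (M q) t) ≈⟨ linearˡ t ⟨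
    det n (X t t)                         ≈⟨ equal t ⟩
    0#                                    ∎)
    where
    X : Vector Carrier n → Vector Carrier n → Matrix n
    X u v = M [ q ]≔ v [ p ]≔ u

    t = λ j → 1# * M p j + M q j

    equal : ∀ u → det n (X u u) ≈ 0#
    equal u = alternating (X u u) p≢q (λ j → reflexive (≡.cong-app (≡.trans ([]≔-updates (M [ q ]≔ u) p)
                (≡.sym (≡.trans ([]≔-minimal (M [ q ]≔ u) (p≢q ∘ ≡.sym)) ([]≔-updates M q)))) j))

    self : X (M p) (M q) ≗ M
    self i = ≡.trans ([]≔-cong ([]≔-self M q) p (M p) i) ([]≔-self M p i)

    linearˡ : ∀ v → det n (X t v) ≈ det n (X (M p) v) + det n (X (M q) v)
    linearˡ v = trans (det-linear (M [ q ]≔ v) p 1# (M p) (M q)) (+-congʳ (*-identityˡ _))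

    linearʳ : ∀ u → det n (X u t) ≈ det n (X u (M p)) + det n (X u (M q))
    linearʳ u = begin
      det n (X u t)                        ≈⟨ det-cong-≗ (updateAt-commutes p q p≢q M) ⟩
      det n (M [ p ]≔ u [ q ]≔ t)          ≈⟨ det-linear (M [ p ]≔ u) q 1# (M p) (M q) ⟩
      1# * det n (M [ p ]≔ u [ q ]≔ M p) + det n (M [ p ]≔ u [ q ]≔ M q)
        ≈⟨ +-cong (trans (*-identityˡ _) (det-cong-≗ (updateAt-commutes q p (p≢q ∘ ≡.sym) M)))
                  (det-cong-≗ (updateAt-commutes q p (p≢q ∘ ≡.sym) M)) ⟩
      det n (X u (M p)) + det n (X u (M q)) ∎

  -x*-y≈x*y : ∀ x y → - x * - y ≈ x * y
  -x*-y≈x*y x y = trans (sym (-‿distribˡ-* x (- y))) (trans (-‿cong (sym (-‿distribʳ-* x y))) (-‿involutive _))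

  sign-punchOut : ∀ {n} (j k : Fin (suc n)) (j≢k : j ≢ k) (k≢j : k ≢ j) →
                  sign j * sign (punchOut j≢k) ≈ - (sign k * sign (punchOut k≢j))
  sign-punchOut zero zero j≢k _ = ⊥-elim (j≢k ≡.refl)
  sign-punchOut {suc n} zero (suc k) _ _ =
    trans (*-identityˡ _) (trans (sym (-‿involutive _)) (-‿cong (sym (*-identityʳ _))))
  sign-punchOut {suc n} (suc j) zero _ _ = trans (*-identityʳ _) (-‿cong (sym (*-identityˡ _)))
  sign-punchOut {suc n} (suc j) (suc k) j≢k k≢j = begin
    - sign j * - sign (punchOut (j≢k ∘ ≡.cong suc))   ≈⟨ -x*-y≈x*y _ _ ⟩
    sign j * sign (punchOut (j≢k ∘ ≡.cong suc))       ≈⟨ sign-punchOut j k (j≢k ∘ ≡.cong suc) (k≢j ∘ ≡.cong suc) ⟩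
    - (sign k * sign (punchOut (k≢j ∘ ≡.cong suc)))   ≈⟨ -‿cong (-x*-y≈x*y _ _) ⟨
    - (- sign k * - sign (punchOut (k≢j ∘ ≡.cong suc))) ∎

  -- Expanding twice along the equal rows 0 and 1, the term for the column pair (j , k)
  -- cancels the term for (k , j).
  module _ {n} (M : Matrix (suc (suc n))) where
    private
      D : Fin (suc (suc n)) → Fin (suc n) → Carrier
      D j b = det n (minor (minor M j) b)

      pairTermWith : ∀ j k → Dec (j ≡ k) → Carrier
      pairTermWith j k (yes _)  = 0#
      pairTermWith j k (no j≢k) = (sign j * sign (punchOut j≢k)) * ((M zero j * M zero k) * D j (punchOut j≢k))

      pairTerm-antisym : ∀ j k (j≟k : Dec (j ≡ k)) (k≟j : Dec (k ≡ j)) →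
                         pairTermWith j k j≟k ≈ - pairTermWith k j k≟j
      pairTerm-antisym j k (yes _)   (yes _)   = sym -0#≈0#
      pairTerm-antisym j k (yes j≡k) (no k≢j)  = ⊥-elim (k≢j (≡.sym j≡k))
      pairTerm-antisym j k (no j≢k)  (yes k≡j) = ⊥-elim (j≢k (≡.sym k≡j))
      pairTerm-antisym j k (no j≢k)  (no k≢j)  = begin
        (sign j * sign (punchOut j≢k)) * ((M zero j * M zero k) * D j (punchOut j≢k))
          ≈⟨ *-cong (sign-punchOut j k j≢k k≢j) (*-congˡ (det-cong (λ a y →
               reflexive (≡.cong (M (suc (suc a))) (double-punchIn-symmetric j k j≢k k≢j y))))) ⟩
        - (sign k * sign (punchOut k≢j)) * ((M zero j * M zero k) * D k (punchOut k≢j))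
          ≈⟨ -‿distribˡ-* _ _ ⟨
        - ((sign k * sign (punchOut k≢j)) * ((M zero j * M zero k) * D k (punchOut k≢j)))
          ≈⟨ -‿cong (*-congˡ (*-congʳ (*-comm _ _))) ⟩
        - ((sign k * sign (punchOut k≢j)) * ((M zero k * M zero j) * D k (punchOut k≢j))) ∎

      pairTerm-diag : ∀ j (j≟j : Dec (j ≡ j)) → pairTermWith j j j≟j ≈ 0#
      pairTerm-diag j (yes _)  = refl
      pairTerm-diag j (no j≢j) = ⊥-elim (j≢j ≡.refl)

      pairTerm : Fin (suc (suc n)) → Fin (suc (suc n)) → Carrier
      pairTerm j k = pairTermWith j k (j ≟ k)

      regroup : ∀ s t a b d → s * (a * (t * (b * d))) ≈ (s * t) * ((a * b) * d)
      regroup = solve 5 (λ s t a b d → s :* (a :* (t :* (b :* d))) := (s :* t) :* ((a :* b) :* d)) refl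

      laplaceTerm-pairs : (∀ j → M zero j ≈ M (suc zero) j) → ∀ j → laplaceTerm M j ≈ sum (pairTerm j)
      laplaceTerm-pairs rows j = begin
        sign j * (M zero j * det (suc n) (minor M j))
          ≈⟨ *-congˡ (*-congˡ (det-laplace (minor M j))) ⟩
        sign j * (M zero j * sum (laplaceTerm (minor M j)))
          ≈⟨ trans (*-congˡ (*-distribˡ-sum (M zero j) (laplaceTerm (minor M j))))
                  (*-distribˡ-sum (sign j) (λ b → M zero j * laplaceTerm (minor M j) b)) ⟩
        sum (λ b → sign j * (M zero j * laplaceTerm (minor M j) b))  ≈⟨ sum-cong-≋ term ⟩
        sum (λ b → pairTerm j (punchIn j b))                         ≈⟨ +-identityˡ _ ⟨
        0# + sum (λ b → pairTerm j (punchIn j b))                    ≈⟨ +-congʳ (pairTerm-diag j (j ≟ j)) ⟨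
        pairTerm j j + sum (removeAt (pairTerm j) j)                 ≈⟨ sum-remove (pairTerm j) ⟨
        sum (pairTerm j)                                             ∎
        where
        term : ∀ b → sign j * (M zero j * laplaceTerm (minor M j) b) ≈ pairTerm j (punchIn j b)
        term b with j ≟ punchIn j b
        ... | yes j≡jb = ⊥-elim (punchInᵢ≢i j b (≡.sym j≡jb))
        ... | no j≢jb  = begin
          sign j * (M zero j * (sign b * (M (suc zero) (punchIn j b) * D j b)))
            ≈⟨ regroup _ _ _ _ _ ⟩
          (sign j * sign b) * ((M zero j * M (suc zero) (punchIn j b)) * D j b)
            ≈⟨ *-congˡ (*-congʳ (*-congˡ (rows (punchIn j b)))) ⟨
          (sign j * sign b) * ((M zero j * M zero (punchIn j b)) * D j b)
            ≡⟨ ≡.cong (λ b′ → (sign j * sign b′) * ((M zero j * M zero (punchIn j b)) * D j b′))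
                      (≡.sym (≡.trans (punchOut-cong j ≡.refl) (punchOut-punchIn j))) ⟩
          (sign j * sign (punchOut j≢jb)) * ((M zero j * M zero (punchIn j b)) * D j (punchOut j≢jb)) ∎

    det-equalRows₀₁ : (∀ j → M zero j ≈ M (suc zero) j) → det (suc (suc n)) M ≈ 0#
    det-equalRows₀₁ rows = begin
      det (suc (suc n)) M           ≈⟨ det-laplace M ⟩
      sum (laplaceTerm M)           ≈⟨ sum-cong-≋ (laplaceTerm-pairs rows) ⟩
      sum (λ j → sum (pairTerm j))
        ≈⟨ sum-antisymmetric pairTerm (λ j k → pairTerm-antisym j k (j ≟ k) (k ≟ j)) (λ j → pairTerm-diag j (j ≟ j)) ⟩
      0#                            ∎

  -- M′ swaps rows 1 and q + 2 of M, so its rows 0 and 1 agree, while each of its minors is the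
  -- corresponding minor of M with two rows swapped; hence det M′ = − det M.
  det-equalRows₀ : ∀ {n} → Alternating n → ∀ (M : Matrix (suc n)) q →
                   (∀ j → M zero j ≈ M (suc q) j) → det (suc n) M ≈ 0#
  det-equalRows₀ {suc n} _           M zero    rows = det-equalRows₀₁ M rows
  det-equalRows₀ {suc n} alternating M (suc q) rows = begin
    det (suc (suc n)) M                                ≈⟨ +-identityʳ _ ⟨
    det (suc (suc n)) M + 0#                           ≈⟨ +-congˡ (det-equalRows₀₁ M′ rows) ⟨
    det (suc (suc n)) M + det (suc (suc n)) M′         ≈⟨ +-cong (det-laplace M) (det-laplace M′) ⟩
    sum (laplaceTerm M) + sum (laplaceTerm M′)         ≈⟨ ∑-distrib-+ (laplaceTerm M) (laplaceTerm M′) ⟨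
    sum (λ j → laplaceTerm M j + laplaceTerm M′ j)     ≈⟨ sum-zero cancel ⟩
    0#                                                 ∎
    where
    M′ : Matrix (suc (suc n))
    M′ = M [ suc (suc q) ]≔ M (suc zero) [ suc zero ]≔ M (suc (suc q))

    minor-M′ : ∀ j → minor M′ j ≗ minor M j [ suc q ]≔ minor M j zero [ zero ]≔ minor M j (suc q)
    minor-M′ j a = ≡.trans (minor-[]≔ (M [ suc (suc q) ]≔ M (suc zero)) zero (M (suc (suc q))) j a)
                           ([]≔-cong (minor-[]≔ M (suc q) (M (suc zero)) j) zero _ a)

    cancel : ∀ j → laplaceTerm M j + laplaceTerm M′ j ≈ 0#
    cancel j = begin
      laplaceTerm M j + sign j * (M zero j * det (suc n) (minor M′ j))
        ≈⟨ +-congˡ (*-congˡ (*-congˡ (trans (det-cong-≗ (minor-M′ j))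
                                            (det-swapRows alternating (minor M j) {zero} {suc q} (λ ()))))) ⟩
      laplaceTerm M j + sign j * (M zero j * - det (suc n) (minor M j))
        ≈⟨ +-congˡ (trans (-‿distribʳ-* _ _) (*-congˡ (-‿distribʳ-* _ _))) ⟨
      laplaceTerm M j + - laplaceTerm M j                ≈⟨ -‿inverseʳ _ ⟩
      0#                                                 ∎

  det-alternating : ∀ n → Alternating n
  det-alternating (suc n) M {zero}  {zero}  0≢0 _    = ⊥-elim (0≢0 ≡.refl)
  det-alternating (suc n) M {zero}  {suc q} _   rows = det-equalRows₀ (det-alternating n) M q rows
  det-alternating (suc n) M {suc p} {zero}  _   rows = det-equalRows₀ (det-alternating n) M p (sym ∘ rows)
  det-alternating (suc n) M {suc p} {suc q} p≢q rows = trans (det-laplace M) (sum-zero λ j →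
    trans (*-congˡ {sign j} (trans (*-congˡ {M zero j}
                                      (det-alternating n (minor M j) (p≢q ∘ ≡.cong suc) (rows ∘ punchIn j)))
                                   (zeroʳ _)))
          (zeroʳ _))

  det-[]≔-sum : ∀ {n m} (M : Matrix n) p (μ : Vector Carrier m) (f : Vector (Vector Carrier n) m) →
                det n (M [ p ]≔ (λ j → sum (λ i → μ i * f i j))) ≈ sum (λ i → μ i * det n (M [ p ]≔ f i))
  det-[]≔-sum {m = zero}  M p μ f = det-zeroRow M p
  det-[]≔-sum {m = suc m} M p μ f =
    trans (det-linear M p (μ zero) (f zero) _) (+-congˡ (det-[]≔-sum M p (tail μ) (tail f)))

  rowCombination : ∀ {n} → Vector Carrier n → Matrix n → Vector Carrier n
  rowCombination x M j = sum (λ i → x i * M i j)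

  det-rowCombination : ∀ {n} (M : Matrix n) (x : Vector Carrier n) p →
                       x p * det n M ≈ det n (M [ p ]≔ rowCombination x M)
  det-rowCombination {suc n} M x p = sym (begin
    det (suc n) (M [ p ]≔ (λ j → sum (λ i → x i * M i j)))  ≈⟨ det-[]≔-sum M p x M ⟩
    sum (λ i → x i * det (suc n) (M [ p ]≔ M i))           ≈⟨ sum-remove (λ i → x i * det (suc n) (M [ p ]≔ M i)) ⟩
    x p * det (suc n) (M [ p ]≔ M p) + sum (λ b → x (punchIn p b) * det (suc n) (M [ p ]≔ M (punchIn p b)))
      ≈⟨ +-cong (*-congˡ (det-cong-≗ ([]≔-self M p))) (sum-zero others) ⟩
    x p * det (suc n) M + 0#                                ≈⟨ +-identityʳ _ ⟩
    x p * det (suc n) M                                     ∎)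
    where
    others : ∀ b → x (punchIn p b) * det (suc n) (M [ p ]≔ M (punchIn p b)) ≈ 0#
    others b = trans (*-congˡ (det-alternating (suc n) (M [ p ]≔ M i) (punchInᵢ≢i p b ∘ ≡.sym) rows)) (zeroʳ _)
      where
      i = punchIn p b
      rows : ∀ j → (M [ p ]≔ M i) p j ≈ (M [ p ]≔ M i) i j
      rows j = reflexive (≡.cong-app (≡.trans ([]≔-updates M p) (≡.sym ([]≔-minimal M (punchInᵢ≢i p b)))) j)

  rowCombination-+ : ∀ {n} (x y : Vector Carrier n) M j →
                    rowCombination (λ i → x i + y i) M j ≈ rowCombination x M j + rowCombination y M j
  rowCombination-+ x y M j =
    trans (sum-cong-≋ (λ i → distribʳ (M i j) (x i) (y i))) (∑-distrib-+ (λ i → x i * M i j) (λ i → y i * M i j))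

  δ : ∀ {n} → Fin n → Vector Carrier n
  δ p i with i ≟ p
  ... | yes _ = 1#
  ... | no _  = 0#

  δ-diagonal : ∀ {n} (p : Fin n) → δ p p ≈ 1#
  δ-diagonal p with p ≟ p
  ... | yes _   = refl
  ... | no p≢p  = ⊥-elim (p≢p ≡.refl)

  δ-offDiagonal : ∀ {n} {p i : Fin n} → i ≢ p → δ p i ≈ 0#
  δ-offDiagonal {p = p} {i} i≢p with i ≟ p
  ... | yes i≡p = ⊥-elim (i≢p i≡p)
  ... | no _    = refl

  rowCombination-δ : ∀ {n} k (p : Fin n) M j → rowCombination (λ i → k * δ p i) M j ≈ k * M p j
  rowCombination-δ {suc n} k p M j = begin
    sum (λ i → (k * δ p i) * M i j)          ≈⟨ sum-remove (λ i → (k * δ p i) * M i j) ⟩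
    (k * δ p p) * M p j + sum (λ b → (k * δ p (punchIn p b)) * M (punchIn p b) j)
      ≈⟨ +-cong (*-congʳ (trans (*-congˡ (δ-diagonal p)) (*-identityʳ k)))
                (sum-zero (λ b → trans (*-congʳ (trans (*-congˡ (δ-offDiagonal (punchInᵢ≢i p b))) (zeroʳ k)))
                                       (zeroˡ _))) ⟩
    k * M p j + 0#                           ≈⟨ +-identityʳ _ ⟩
    k * M p j                                ∎

  -- With N = M [ p ]≔ 1: x p · det M = c · det N, and since y p = 0 the combination y of N is still
  -- the constant d, so y q · det N = d · det (N with rows p and q both 1) = 0.
  det-two-constant-combinations : ∀ {n} (M : Matrix n) (x y : Vector Carrier n) {c d p q} → p ≢ q →
                                  (∀ j → rowCombination x M j ≈ c) → (∀ j → rowCombination y M j ≈ d) →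
                                  y p ≈ 0# → (x p * y q) * det n M ≈ 0#
  det-two-constant-combinations {n} M x y {c} {d} {p} {q} p≢q xM≈c yM≈d yp≈0 = begin
    (x p * y q) * det n M    ≈⟨ *-congʳ (*-comm _ _) ⟩
    (y q * x p) * det n M    ≈⟨ *-assoc _ _ _ ⟩
    y q * (x p * det n M)    ≈⟨ *-congˡ xp-det ⟩
    y q * (c * det n N)      ≈⟨ x∙yz≈y∙xz _ _ _ ⟩
    c * (y q * det n N)      ≈⟨ *-congˡ yq-det ⟩
    c * 0#                   ≈⟨ zeroʳ c ⟩
    0#                       ∎
    where
    open import Algebra.Properties.CommutativeSemigroup *-commutativeSemigroup using (x∙yz≈y∙xz)

    𝟙 : Vector Carrier n
    𝟙 _ = 1#

    N : Matrix n
    N = M [ p ]≔ 𝟙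

    scaled-𝟙 : ∀ {v e} → v ≈ e → v ≈ e * 1#
    scaled-𝟙 v≈e = trans v≈e (sym (*-identityʳ _))

    xp-det : x p * det n M ≈ c * det n N
    xp-det = trans (det-rowCombination M x p)
                   (trans (det-row-cong M p (scaled-𝟙 ∘ xM≈c)) (det-scaleRow M p c 𝟙))

    yN≈yM : ∀ j → rowCombination y N j ≈ rowCombination y M j
    yN≈yM j = sum-cong-≋ term
      where
      term : ∀ i → y i * N i j ≈ y i * M i j
      term i with i ≟ p
      ... | yes ≡.refl = trans (trans (*-congʳ yp≈0) (zeroˡ _)) (sym (trans (*-congʳ yp≈0) (zeroˡ _)))
      ... | no i≢p     = *-congˡ (reflexive (≡.cong-app ([]≔-minimal M i≢p) j))

    yq-det : y q * det n N ≈ 0#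
    yq-det = begin
      y q * det n N                ≈⟨ det-rowCombination N y q ⟩
      det n (N [ q ]≔ rowCombination y N)
        ≈⟨ det-row-cong N q (λ j → scaled-𝟙 (trans (yN≈yM j) (yM≈d j))) ⟩
      det n (N [ q ]≔ (λ j → d * 𝟙 j))  ≈⟨ det-scaleRow N q d 𝟙 ⟩
      d * det n (N [ q ]≔ 𝟙)           ≈⟨ *-congˡ (det-alternating n (N [ q ]≔ 𝟙) p≢q rows) ⟩
      d * 0#                          ≈⟨ zeroʳ d ⟩
      0#                              ∎
      where
      rows : ∀ j → (N [ q ]≔ 𝟙) p j ≈ (N [ q ]≔ 𝟙) q j
      rows j = reflexive (≡.cong-app (≡.trans ([]≔-minimal N p≢q)
                 (≡.trans ([]≔-updates M p) (≡.sym ([]≔-updates N q)))) j)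

module Walks {n m : ℕ} (ends : Fin m → Fin n × Fin n) where
  open Graphs ends
  open DecMembership (_≟_ {n}) using (_∈?_)

  Walk : Set
  Walk = List (Fin m × Fin n)

  vertices : Fin n → Walk → List (Fin n)
  vertices u s = u ∷ map proj₂ s

  edges : Walk → List (Fin m)
  edges = map proj₁

  Joins-sym : ∀ {e a b} → Joins e a b → Joins e b a
  Joins-sym = Sum.swap

  Joins-functional : ∀ {e x y z} → Joins e x y → Joins e x z → y ≡ z
  Joins-functional (inj₁ (_ , q)) (inj₁ (_ , q′)) = ≡.trans (≡.sym q) q′
  Joins-functional (inj₁ (p , q)) (inj₂ (p′ , q′)) = ≡.trans (≡.sym q) (≡.trans q′ (≡.trans (≡.sym p) p′))
  Joins-functional (inj₂ (p , q)) (inj₁ (p′ , q′)) = ≡.trans (≡.sym p) (≡.trans p′ (≡.trans (≡.sym q) q′))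
  Joins-functional (inj₂ (p , _)) (inj₂ (p′ , _)) = ≡.trans (≡.sym p) p′

  Joins-endpoint : ∀ {e v w a b} → Joins e v w → Joins e a b → a ≡ v ⊎ a ≡ w
  Joins-endpoint (inj₁ (p , _)) (inj₁ (p′ , _)) = inj₁ (≡.trans (≡.sym p′) p)
  Joins-endpoint (inj₁ (_ , q)) (inj₂ (_ , q′)) = inj₂ (≡.trans (≡.sym q′) q)
  Joins-endpoint (inj₂ (p , _)) (inj₁ (p′ , _)) = inj₂ (≡.trans (≡.sym p′) p)
  Joins-endpoint (inj₂ (_ , q)) (inj₂ (_ , q′)) = inj₁ (≡.trans (≡.sym q′) q)

  endpoint-∈ : ∀ u s → endpoint u s ∈ vertices u s
  endpoint-∈ u []            = here ≡.refl
  endpoint-∈ u ((_ , v) ∷ s) = there (endpoint-∈ v s)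

  Joins-∈ : ∀ {v} s → IsWalk v s → ∀ {e a b} → e ∈ edges s → Joins e a b → a ∈ vertices v s
  Joins-∈ ((_ , w) ∷ s) (J , _)  (here ≡.refl) J′ = [ here , there ∘ here ]′ (Joins-endpoint J J′)
  Joins-∈ ((_ , w) ∷ s) (_ , ws) (there e∈s)   J′ = there (Joins-∈ s ws e∈s J′)

  path-edges-unique : ∀ {u} s → IsWalk u s → Unique (vertices u s) → Unique (edges s)
  path-edges-unique []            _        _          = []
  path-edges-unique ((e , v) ∷ s) (J , ws) (u∉ ∷ us) =
    ¬Any⇒All¬ (edges s) (λ e∈s → All¬⇒¬Any u∉ (Joins-∈ s ws e∈s J)) ∷ path-edges-unique s ws us

  IsWalk-++ : ∀ u s t → IsWalk u s → IsWalk (endpoint u s) t → IsWalk u (s ++ t)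
  IsWalk-++ u []            t _        wt = wt
  IsWalk-++ u ((e , v) ∷ s) t (J , ws) wt = J , IsWalk-++ v s t ws wt

  endpoint-++ : ∀ u s t → endpoint u (s ++ t) ≡ endpoint (endpoint u s) t
  endpoint-++ u []            t = ≡.refl
  endpoint-++ u ((e , v) ∷ s) t = endpoint-++ v s t

  reverse : Fin n → Walk → Walk
  reverse u []            = []
  reverse u ((e , v) ∷ s) = reverse v s ++ (e , u) ∷ []

  endpoint-reverse : ∀ u s → endpoint (endpoint u s) (reverse u s) ≡ u
  endpoint-reverse u []            = ≡.refl
  endpoint-reverse u ((e , v) ∷ s) = endpoint-++ (endpoint v s) (reverse v s) _

  IsWalk-reverse : ∀ u s → IsWalk u s → IsWalk (endpoint u s) (reverse u s)
  IsWalk-reverse u []            _        = tt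
  IsWalk-reverse u ((e , v) ∷ s) (J , ws) =
    IsWalk-++ (endpoint v s) (reverse v s) _ (IsWalk-reverse v s ws)
      (≡.subst (λ x → Joins e x u) (≡.sym (endpoint-reverse v s)) (Joins-sym J) , tt)

  edges-reverse : ∀ u s → edges (reverse u s) ⊆ edges s
  edges-reverse u ((e , v) ∷ s) e∈
    with ∈-++⁻ (edges (reverse v s)) (≡.subst (_ ∈_) (map-++ proj₁ (reverse v s) _) e∈)
  ... | inj₁ e∈rev     = there (edges-reverse v s e∈rev)
  ... | inj₂ (here eq) = here eq

  path-split : ∀ {v y x} P → IsPath v y P → x ∈ vertices v P →
               Σ Walk λ pre → Σ Walk λ suf → P ≡ pre ++ suf × IsPath v x pre × IsPath x y suf
  path-split P pP (here ≡.refl) = [] , P , ≡.refl , (tt , ≡.refl , [] ∷ []) , pP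
  path-split ((g , z) ∷ P) ((J , w) , e , (v∉ ∷ u)) (there x∈) with path-split P (w , e , u) x∈
  ... | pre , suf , ≡.refl , (wp , ep , up) , ps =
    (g , z) ∷ pre , suf , ≡.refl ,
    ((J , wp) , ep , (++⁻ˡ (vertices z pre) (≡.subst (All _) (≡.cong (z ∷_) (map-++ proj₂ pre suf)) v∉) ∷ up)) , ps

  walk⇒path : ∀ u W → IsWalk u W → Σ Walk λ Q → IsPath u (endpoint u W) Q × edges Q ⊆ edges W
  walk⇒path u [] _ = [] , (tt , ≡.refl , [] ∷ []) , λ ()
  walk⇒path u ((g , v) ∷ W) (J , w) with walk⇒path v W w
  ... | Q , pQ@(wQ , eQ , uQ) , Q⊆W with u ∈? vertices v Q
  ...   | no u∉ = (g , v) ∷ Q , ((J , wQ) , eQ , (¬Any⇒All¬ _ u∉ ∷ uQ)) , λ where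
    (here e≡g)  → here e≡g
    (there e∈Q) → there (Q⊆W e∈Q)
  ...   | yes u∈ with path-split Q pQ u∈
  ...     | pre , suf , ≡.refl , _ , psuf =
    suf , psuf , there ∘ Q⊆W ∘ ≡.subst (_ ∈_) (≡.sym (map-++ proj₁ pre suf)) ∘ ∈-++⁺ʳ (edges pre)

  Incident : Fin m → Fin n → Set
  Incident g v = proj₁ (ends g) ≡ v ⊎ proj₂ (ends g) ≡ v

  incident? : ∀ v g → Dec (Incident g v)
  incident? v g = (proj₁ (ends g) ≟ v) ⊎-dec (proj₂ (ends g) ≟ v)

  WithinOne : Fin n → Fin n → Set
  WithinOne v x = x ≡ v ⊎ ∃[ f ] Joins f v x

  module _ (acyclic : Acyclic) where

    Joins-irreflexive : ∀ {e u a} → Joins e u a → a ≢ u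
    Joins-irreflexive {e} {u} J ≡.refl =
      acyclic u ((e , u) ∷ []) ((λ ()) , (J , tt) , ≡.refl , ([] ∷ []) , ([] ∷ []))

    no-parallel-edges : ∀ {e₁ e₂ u a} → e₁ ≢ e₂ → Joins e₁ u a → Joins e₂ u a → ⊥
    no-parallel-edges {e₁} {e₂} {u} {a} e₁≢e₂ J₁ J₂ = acyclic u ((e₁ , a) ∷ (e₂ , u) ∷ [])
      ((λ ()) , (J₁ , Joins-sym J₂ , tt) , ≡.refl ,
       ((e₁≢e₂ ∷ []) ∷ [] ∷ []) , ((Joins-irreflexive J₁ ∷ []) ∷ [] ∷ []))

    -- Two paths leaving x along different edges would close up, after shortcutting, to a cycle.
    path-unique : ∀ {x y} s t → IsPath x y s → IsPath x y t → s ≡ t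
    path-unique [] [] _ _ = ≡.refl
    path-unique [] ((f , z) ∷ t) (_ , ≡.refl , _) (_ , et , (x∉ ∷ _)) =
      ⊥-elim (All¬⇒¬Any x∉ (≡.subst (_∈ _) et (endpoint-∈ z t)))
    path-unique ((e , z) ∷ s) [] (_ , es , (x∉ ∷ _)) (_ , ≡.refl , _) =
      ⊥-elim (All¬⇒¬Any x∉ (≡.subst (_∈ _) es (endpoint-∈ z s)))
    path-unique {x} ((e , z) ∷ s) ((f , z′) ∷ t) ((je , ws) , es , (x∉s ∷ us)) ((jf , wt) , et , (x∉t ∷ ut))
      with e ≟ f
    ... | yes ≡.refl with Joins-functional je jf
    ...   | ≡.refl = ≡.cong ((e , z) ∷_) (path-unique s t (ws , es , us) (wt , et , ut))
    path-unique {x} ((e , z) ∷ s) ((f , z′) ∷ t) ((je , ws) , es , (x∉s ∷ us)) ((jf , wt) , et , (x∉t ∷ ut))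
      | no e≢f = ⊥-elim (acyclic x ((e , z) ∷ Q)
          ((λ ()) , (je , wQ) , ≡.trans eQ W-returns ,
           (¬Any⇒All¬ (edges Q) (e∉W ∘ Q⊆W) ∷ path-edges-unique Q wQ uQ) , uQ))
      where
      back = reverse x ((f , z′) ∷ t)
      W = s ++ back

      W-walk : IsWalk z W
      W-walk = IsWalk-++ z s back ws
        (≡.subst (λ v → IsWalk v back) (≡.trans et (≡.sym es)) (IsWalk-reverse x ((f , z′) ∷ t) (jf , wt)))

      W-returns : endpoint z W ≡ x
      W-returns = ≡.trans (endpoint-++ z s back)
        (≡.trans (≡.cong (λ v → endpoint v back) (≡.trans es (≡.sym et))) (endpoint-reverse x ((f , z′) ∷ t)))

      e∉W : e ∉ edges W
      e∉W e∈W with ∈-++⁻ (edges s) (≡.subst (e ∈_) (map-++ proj₁ s back) e∈W)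
      ... | inj₁ e∈s = All¬⇒¬Any x∉s (Joins-∈ s ws e∈s je)
      ... | inj₂ e∈back with edges-reverse x ((f , z′) ∷ t) e∈back
      ...   | here e≡f    = e≢f e≡f
      ...   | there e∈t   = All¬⇒¬Any x∉t (Joins-∈ t wt e∈t je)

      shortcut = walk⇒path z W W-walk
      Q   = proj₁ shortcut
      wQ  = proj₁ (proj₁ (proj₂ shortcut))
      eQ  = proj₁ (proj₂ (proj₁ (proj₂ shortcut)))
      uQ  = proj₂ (proj₂ (proj₁ (proj₂ shortcut)))
      Q⊆W = proj₂ (proj₂ shortcut)

    record DegreeTwo (u : Fin n) : Set where
      field
        e₁ e₂  : Fin m
        a b    : Fin n
        e₁≢e₂  : e₁ ≢ e₂
        J₁     : Joins e₁ u a
        J₂     : Joins e₂ u b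
        only   : ∀ g z → Joins g u z → (g ≡ e₁ × z ≡ a) ⊎ (g ≡ e₂ × z ≡ b)

      a≢u : a ≢ u
      a≢u = Joins-irreflexive J₁

      b≢u : b ≢ u
      b≢u = Joins-irreflexive J₂

      a≢b : a ≢ b
      a≢b a≡b = no-parallel-edges e₁≢e₂ J₁ (≡.subst (Joins e₂ u) (≡.sym a≡b) J₂)

      path-via-e₂ : IsPath u b ((e₂ , b) ∷ [])
      path-via-e₂ = (J₂ , tt) , ≡.refl , ((b≢u ∘ ≡.sym) ∷ []) ∷ [] ∷ []

      path-via-e₁-avoids-b : ∀ {j} s → IsPath u j ((e₁ , a) ∷ s) → b ∉ vertices u ((e₁ , a) ∷ s)
      path-via-e₁-avoids-b s P b∈ with path-split ((e₁ , a) ∷ s) P b∈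
      ... | pre , suf , P≡ , ppre , _ with path-unique pre ((e₂ , b) ∷ []) ppre path-via-e₂
      ...   | ≡.refl = e₁≢e₂ (≡.cong proj₁ (∷-injectiveˡ P≡))

      no-detour : ∀ s → IsPath a b s → All (u ≢_) (vertices a s) → ⊥
      no-detour s (ws , es , us) u∉ =
        path-via-e₁-avoids-b s P (≡.subst (_∈ vertices u ((e₁ , a) ∷ s)) es (endpoint-∈ u ((e₁ , a) ∷ s)))
        where
        P : IsPath u b ((e₁ , a) ∷ s)
        P = (J₁ , ws) , es , (u∉ ∷ us)

      withinOne? : ∀ x → WithinOne u x ⊎ (x ≢ a × x ≢ b × x ≢ u)
      withinOne? x with x ≟ a | x ≟ b | x ≟ u
      ... | yes ≡.refl | _          | _       = inj₁ (inj₂ (e₁ , J₁))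
      ... | no _       | yes ≡.refl | _       = inj₁ (inj₂ (e₂ , J₂))
      ... | no _       | no _       | yes x≡u = inj₁ (inj₁ x≡u)
      ... | no x≢a     | no x≢b     | no x≢u  = inj₂ (x≢a , x≢b , x≢u)

      -- Otherwise u, a, v, b (or u, a, b) would form a cycle.
      not-both-withinOne : ∀ {v} → u ≢ v → WithinOne v a → WithinOne v b → ⊥
      not-both-withinOne _ (inj₁ a≡v) (inj₁ b≡v) = a≢b (≡.trans a≡v (≡.sym b≡v))
      not-both-withinOne _ (inj₁ ≡.refl) (inj₂ (f , Jab)) =
        no-detour ((f , b) ∷ []) ((Jab , tt) , ≡.refl , (a≢b ∷ []) ∷ [] ∷ [])
                  ((a≢u ∘ ≡.sym) ∷ (b≢u ∘ ≡.sym) ∷ [])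
      not-both-withinOne _ (inj₂ (f , Jba)) (inj₁ ≡.refl) =
        no-detour ((f , b) ∷ []) ((Joins-sym Jba , tt) , ≡.refl , (a≢b ∷ []) ∷ [] ∷ [])
                  ((a≢u ∘ ≡.sym) ∷ (b≢u ∘ ≡.sym) ∷ [])
      not-both-withinOne {v} u≢v (inj₂ (f , Jva)) (inj₂ (g , Jvb)) =
        no-detour ((f , v) ∷ (g , b) ∷ []) ((Joins-sym Jva , Jvb , tt) , ≡.refl ,
                    (Joins-irreflexive Jva ∷ a≢b ∷ []) ∷ ((Joins-irreflexive Jvb ∘ ≡.sym) ∷ []) ∷ [] ∷ [])
                  ((a≢u ∘ ≡.sym) ∷ u≢v ∷ (b≢u ∘ ≡.sym) ∷ [])

    swapNeighbours : ∀ {u} → DegreeTwo u → DegreeTwo u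
    swapNeighbours D = record
      { e₁ = e₂ ; e₂ = e₁ ; a = b ; b = a ; e₁≢e₂ = e₁≢e₂ ∘ ≡.sym ; J₁ = J₂ ; J₂ = J₁
      ; only = λ g z J → Sum.swap (only g z J) }
      where open DegreeTwo D

    degree≡2⇒DegreeTwo : ∀ u → degree u ≡ 2 → DegreeTwo u
    degree≡2⇒DegreeTwo u deg with filter (incident? u) (allFin m) in eq
    ... | e₁ ∷ e₂ ∷ [] = record
      { e₁ = e₁ ; e₂ = e₂ ; a = proj₁ (other inc₁) ; b = proj₁ (other inc₂) ; e₁≢e₂ = e₁≢e₂
      ; J₁ = proj₂ (other inc₁) ; J₂ = proj₂ (other inc₂) ; only = only }
      where
      unique : Unique (e₁ ∷ e₂ ∷ [])
      unique = ≡.subst Unique eq (filter⁺ (incident? u) (allFin⁺ m))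

      e₁≢e₂ : e₁ ≢ e₂
      e₁≢e₂ with unique
      ... | (e₁≢e₂ ∷ []) ∷ _ = e₁≢e₂

      incident : ∀ {g} → g ∈ e₁ ∷ e₂ ∷ [] → Incident g u
      incident g∈ = proj₂ (∈-filter⁻ (incident? u) {xs = allFin m} (≡.subst (_ ∈_) (≡.sym eq) g∈))

      inc₁ = incident (here ≡.refl)
      inc₂ = incident (there (here ≡.refl))

      other : ∀ {g} → Incident g u → Σ (Fin n) (Joins g u)
      other {g} (inj₁ p) = proj₂ (ends g) , inj₁ (p , ≡.refl)
      other {g} (inj₂ q) = proj₁ (ends g) , inj₂ (≡.refl , q)

      only : ∀ g z → Joins g u z → (g ≡ e₁ × z ≡ proj₁ (other inc₁)) ⊎ (g ≡ e₂ × z ≡ proj₁ (other inc₂))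
      only g z J
        with ≡.subst (g ∈_) eq (∈-filter⁺ (incident? u) (∈-allFin g) ([ inj₁ ∘ proj₁ , inj₂ ∘ proj₂ ]′ J))
      ... | here ≡.refl         = inj₁ (≡.refl , Joins-functional J (proj₂ (other inc₁)))
      ... | there (here ≡.refl) = inj₂ (≡.refl , Joins-functional J (proj₂ (other inc₂)))

module SquaredDistances {c ℓ} (R : CommutativeRing c ℓ) {n m : ℕ} (ends : Fin m → Fin n × Fin n)
                        (w : Fin m → CommutativeRing.Carrier R) (acyclic : Graphs.Acyclic ends)
                        (Δ : Fin n → Fin n → CommutativeRing.Carrier R)
                        (isΔ : Weighted.IsSquaredDistanceMatrix R ends w Δ) where
  open CommutativeRing R
  open Graphs ends
  open Weighted R ends w
  open Walks ends
  open Determinant R using (rowCombination; rowCombination-+; rowCombination-δ; δ; δ-diagonal; δ-offDiagonal)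
  open import Algebra.Solver.Ring.NaturalCoefficients.Default commutativeSemiring
    using (solve; _:+_; _:*_; _:=_; con)
  open import Relation.Binary.Reasoning.Setoid setoid

  Δ≈pathWeight² : ∀ {i j s} → IsPath i j s → Δ i j ≈ pathWeight s * pathWeight s
  Δ≈pathWeight² {i} {j} {s} P with isΔ i j
  ... | s′ , P′ , Δ≈ with path-unique acyclic s′ s P′ P
  ... | ≡.refl = Δ≈

  module _ {u} (D : DegreeTwo acyclic u) where
    open DegreeTwo D

    private
      α = w e₁
      β = w e₂

    row-identity-via-e₁ : ∀ {j} s → IsPath u j ((e₁ , a) ∷ s) →
                          β * Δ a j + α * Δ b j ≈ α * β * (α + β) + (α + β) * Δ u j
    row-identity-via-e₁ {j} s P@((_ , ws) , es , (_ ∷ us)) = begin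
      β * Δ a j + α * Δ b j
        ≈⟨ +-cong (*-congˡ (Δ≈pathWeight² (ws , es , us))) (*-congˡ (Δ≈pathWeight² P-from-b)) ⟩
      β * (t * t) + α * ((β + (α + t)) * (β + (α + t)))   ≈⟨ identity α β t ⟩
      α * β * (α + β) + (α + β) * ((α + t) * (α + t))     ≈⟨ +-congˡ (*-congˡ (Δ≈pathWeight² P)) ⟨
      α * β * (α + β) + (α + β) * Δ u j                   ∎
      where
      t = pathWeight s

      P-from-b : IsPath b j ((e₂ , u) ∷ (e₁ , a) ∷ s)
      P-from-b = (Joins-sym J₂ , proj₁ P) , es , (¬Any⇒All¬ _ (path-via-e₁-avoids-b s P) ∷ proj₂ (proj₂ P))

      identity : ∀ α β t → β * (t * t) + α * ((β + (α + t)) * (β + (α + t)))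
                           ≈ α * β * (α + β) + (α + β) * ((α + t) * (α + t))
      identity = solve 3 (λ α β t → β :* (t :* t) :+ α :* ((β :+ (α :+ t)) :* (β :+ (α :+ t)))
                                 := α :* β :* (α :+ β) :+ (α :+ β) :* ((α :+ t) :* (α :+ t))) refl

  module _ {u} (D : DegreeTwo acyclic u) where
    open DegreeTwo D

    private
      α = w e₁
      β = w e₂

    row-identity : ∀ j → β * Δ a j + α * Δ b j ≈ α * β * (α + β) + (α + β) * Δ u j
    row-identity j with isΔ u j
    ... | [] , (_ , ≡.refl , _) , Δuu≈ = begin
      β * Δ a u + α * Δ b u
        ≈⟨ +-cong (*-congˡ (Δ≈pathWeight² ((Joins-sym J₁ , tt) , ≡.refl , (a≢u ∷ []) ∷ [] ∷ [])))
                  (*-congˡ (Δ≈pathWeight² ((Joins-sym J₂ , tt) , ≡.refl , (b≢u ∷ []) ∷ [] ∷ []))) ⟩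
      β * ((α + 0#) * (α + 0#)) + α * ((β + 0#) * (β + 0#))  ≈⟨ identity α β ⟩
      α * β * (α + β) + (α + β) * (0# * 0#)                  ≈⟨ +-congˡ (*-congˡ Δuu≈) ⟨
      α * β * (α + β) + (α + β) * Δ u u                      ∎
      where
      identity : ∀ α β → β * ((α + 0#) * (α + 0#)) + α * ((β + 0#) * (β + 0#))
                         ≈ α * β * (α + β) + (α + β) * (0# * 0#)
      identity = solve 2 (λ α β → β :* ((α :+ con 0) :* (α :+ con 0)) :+ α :* ((β :+ con 0) :* (β :+ con 0))
                                := α :* β :* (α :+ β) :+ (α :+ β) :* (con 0 :* con 0)) refl
    ... | (g , z) ∷ s , P@((J , _) , _) , _ with only g z J
    ...   | inj₁ (≡.refl , ≡.refl) = row-identity-via-e₁ D s P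
    ...   | inj₂ (≡.refl , ≡.refl) =
      trans (+-comm _ _) (trans (row-identity-via-e₁ (swapNeighbours acyclic D) s P) (swap α β _))
      where
      swap : ∀ α β x → β * α * (β + α) + (β + α) * x ≈ α * β * (α + β) + (α + β) * x
      swap = solve 3 (λ α β x → β :* α :* (β :+ α) :+ (β :+ α) :* x := α :* β :* (α :+ β) :+ (α :+ β) :* x) refl

    combination : Fin n → Carrier
    combination i = β * δ a i + (α * δ b i + - (α + β) * δ u i)

    combination-constant : ∀ j → rowCombination combination Δ j ≈ α * β * (α + β)
    combination-constant j = begin
      rowCombination combination Δ j
        ≈⟨ trans (rowCombination-+ _ _ Δ j) (+-congˡ (rowCombination-+ _ _ Δ j)) ⟩
      rowCombination (λ i → β * δ a i) Δ j + (rowCombination (λ i → α * δ b i) Δ j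
                                             + rowCombination (λ i → - (α + β) * δ u i) Δ j)
        ≈⟨ +-cong (rowCombination-δ β a Δ j) (+-cong (rowCombination-δ α b Δ j) (rowCombination-δ _ u Δ j)) ⟩
      β * Δ a j + (α * Δ b j + - (α + β) * Δ u j)   ≈⟨ +-assoc _ _ _ ⟨
      (β * Δ a j + α * Δ b j) + - (α + β) * Δ u j   ≈⟨ +-cong (sym (row-identity j)) (-‿distribˡ-* _ _) ⟨
      (K + (α + β) * Δ u j) + - ((α + β) * Δ u j)   ≈⟨ +-assoc _ _ _ ⟩
      K + ((α + β) * Δ u j + - ((α + β) * Δ u j))   ≈⟨ +-congˡ (-‿inverseʳ _) ⟩
      K + 0#                                        ≈⟨ +-identityʳ K ⟩
      K                                             ∎
      where
      K = α * β * (α + β)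
      open import Algebra.Properties.Ring ring using (-‿distribˡ-*)

    combination-a : combination a ≈ β
    combination-a = begin
      β * δ a a + (α * δ b a + - (α + β) * δ u a)
        ≈⟨ +-cong (*-congˡ (δ-diagonal a)) (+-cong (*-congˡ (δ-offDiagonal a≢b)) (*-congˡ (δ-offDiagonal a≢u))) ⟩
      β * 1# + (α * 0# + - (α + β) * 0#)  ≈⟨ +-cong (*-identityʳ β) (trans (+-cong (zeroʳ α) (zeroʳ _)) (+-identityʳ 0#)) ⟩
      β + 0#                              ≈⟨ +-identityʳ β ⟩
      β                                   ∎

    combination-outside : ∀ {p} → p ≢ a → p ≢ b → p ≢ u → combination p ≈ 0#
    combination-outside p≢a p≢b p≢u =
      trans (+-cong (trans (*-congˡ (δ-offDiagonal p≢a)) (zeroʳ β))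
                    (+-cong (trans (*-congˡ (δ-offDiagonal p≢b)) (zeroʳ α)) (trans (*-congˡ (δ-offDiagonal p≢u)) (zeroʳ _))))
            (trans (+-identityˡ _) (+-identityʳ 0#))

module _ {c ℓ} (ℝ : RealField c ℓ) where
  open RealField ℝ

  *-cancelˡ-≈0 : ∀ {x y} → ¬ (x ≈ 0#) → x * y ≈ 0# → y ≈ 0#
  *-cancelˡ-≈0 {x} {y} x≉0 xy≈0 with inverse x x≉0
  ... | x⁻¹ , xx⁻¹≈1 = begin
    y              ≈⟨ *-identityˡ y ⟨
    1# * y         ≈⟨ *-congʳ (trans (sym xx⁻¹≈1) (*-comm x x⁻¹)) ⟩
    (x⁻¹ * x) * y  ≈⟨ *-assoc x⁻¹ x y ⟩
    x⁻¹ * (x * y)  ≈⟨ *-congˡ xy≈0 ⟩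
    x⁻¹ * 0#       ≈⟨ zeroʳ x⁻¹ ⟩
    0#             ∎
    where open import Relation.Binary.Reasoning.Setoid setoid

module TwoVerticesOfDegreeTwo {c ℓ} (ℝ : RealField c ℓ) {n m : ℕ} (ends : Fin m → Fin n × Fin n)
                              (w : Fin m → RealField.Carrier ℝ)
                              (w≉0 : ∀ e → ¬ (RealField._≈_ ℝ (w e) (RealField.0# ℝ)))
                              (acyclic : Graphs.Acyclic ends) (Δ : Fin n → Fin n → RealField.Carrier ℝ)
                              (isΔ : Weighted.IsSquaredDistanceMatrix (RealField.commRing ℝ) ends w Δ) where
  open RealField ℝ
  open Graphs ends
  open Matrices commRing using (det)
  open Determinant commRing using (det-two-constant-combinations)
  open Walks ends
  open SquaredDistances commRing ends w acyclic Δ isΔ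

  far-neighbour⇒det≈0 : ∀ {u v} (Du : DegreeTwo acyclic u) (Dv : DegreeTwo acyclic v) →
                        let a = DegreeTwo.a Du in a ≢ DegreeTwo.a Dv × a ≢ DegreeTwo.b Dv × a ≢ v →
                        det n Δ ≈ 0#
  far-neighbour⇒det≈0 Du Dv (a≢a′ , a≢b′ , a≢v) =
    *-cancelˡ-≈0 ℝ (nonzero Dv) (*-cancelˡ-≈0 ℝ (nonzero Du) (trans (sym (*-assoc _ _ _))
      (det-two-constant-combinations Δ (combination Du) (combination Dv) a≢a′
        (combination-constant Du) (combination-constant Dv) (combination-outside Dv a≢a′ a≢b′ a≢v))))
    where
    nonzero : ∀ {x} (D : DegreeTwo acyclic x) → ¬ (combination D (DegreeTwo.a D) ≈ 0#)
    nonzero D c≈0 = w≉0 (DegreeTwo.e₂ D) (trans (sym (combination-a D)) c≈0)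

  degreeTwo-pair⇒det≈0 : ∀ {u v} → DegreeTwo acyclic u → DegreeTwo acyclic v → u ≢ v → det n Δ ≈ 0#
  degreeTwo-pair⇒det≈0 Du Dv u≢v with DegreeTwo.withinOne? Dv (DegreeTwo.a Du) | DegreeTwo.withinOne? Dv (DegreeTwo.b Du)
  ... | inj₂ a-far    | _          = far-neighbour⇒det≈0 Du Dv a-far
  ... | inj₁ _        | inj₂ b-far = far-neighbour⇒det≈0 (swapNeighbours acyclic Du) Dv b-far
  ... | inj₁ a-near   | inj₁ b-near = ⊥-elim (DegreeTwo.not-both-withinOne Du u≢v a-near b-near)

corollary3p4 : ∀ {c ℓ} (ℝ : RealField c ℓ) (k : ℕ)
    (ends : Fin k → Fin (suc k) × Fin (suc k))
    (w : Fin k → RealField.Carrier ℝ) →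
    (∀ e → ¬ (RealField._≈_ ℝ (w e) (RealField.0# ℝ))) →
    Graphs.IsTree ends →
    (∃[ u ] ∃[ v ] (u ≢ v × Graphs.degree ends u ≡ 2 × Graphs.degree ends v ≡ 2)) →
    (Δ : Fin (suc k) → Fin (suc k) → RealField.Carrier ℝ) →
    Weighted.IsSquaredDistanceMatrix (RealField.commRing ℝ) ends w Δ →
    RealField._≈_ ℝ (Matrices.det (RealField.commRing ℝ) (suc k) Δ) (RealField.0# ℝ)
corollary3p4 ℝ k ends w w≉0 (_ , acyclic) (u , v , u≢v , deg-u , deg-v) Δ isΔ =
  TwoVerticesOfDegreeTwo.degreeTwo-pair⇒det≈0 ℝ ends w w≉0 acyclic Δ isΔ
    (degree≡2⇒DegreeTwo acyclic u deg-u) (degree≡2⇒DegreeTwo acyclic v deg-v) u≢v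
  where open Walks ends
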